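{- Let $Z=(U,\Omega,r)$ be a $q$-matroid with $q\ge 2$ and let $\prec$ be a total ordering of its skew classes. Then each transversal $T$ of $\Omega$ belongs to $H_Z(B)$ for exactly $(q-1)^{n(T)}$ bases $B$ of $Z$.
   Context: A carrier is a pair $(U,\Omega)$ with $U$ finite and $\Omega$ a partition of $U$ into non-empty skew classes; a subtransversal meets each skew class at most once, a transversal exactly once; a skew pair is two distinct elements of one skew class. A multimatroid $Z=(U,\Omega,r)$ has a non-negative integer function $r$ on subtransversals with (R1) on each transversal $r$ is a matroid rank function; (R2) for every subtransversal $S$ and skew pair $\{x,y\}$ in a skew class disjoint from $S$, $r(S\cup\{x\})+r(S\cup\{y\})-2r(S)\ge1$. A $q$-matroid is a multimatroid all of whose skew classes have size $q$. $n(S)=|S|-r(S)$; bases are maximal subtransversals with $n=0$ (transversals when $q\ge 2$); circuits are minimal subtransversals with $n>0$. $S_\omega$ is the element of $S\cap\omega$. For a basis $B$ and skew class $\omega$, $B\cup\omega$ contains at most one circuit, denoted $C(B,\omega)$ when it exists, and $\underline B_\omega$ is the element of $C(B,\omega)-B$. The total order $\prec$ on skew classes orders the elements of any subtransversal; $\min$ is the least element. $\omega$ is active w.r.t. $B$ if $C(B,\omega)$ exists and $\min C(B,\omega)\in\omega$; $\mathrm{act}_\prec(B)$ is the set of these. $H_Z(B)$ is the set of transversals $T$ with $B-\{B_\omega:\omega\in\mathrm{act}_\prec(B)\}\subseteq T\subseteq B\cup\{\underline B_\omega:\omega\in\mathrm{act}_\prec(B)\}$. -}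

module Defs where

open import Data.Nat using (ℕ; zero; suc; _+_; _∸_; _≤_; _<_)
open import Data.Fin using (Fin)
open import Data.Fin.Properties using () renaming (_≟_ to _≟F_)
open import Data.Maybe using (Maybe; just; nothing)
open import Data.Vec using (Vec; lookup; map; tabulate; []; _∷_; _[_]≔_)
open import Data.Product using (_×_; ∃)
open import Data.Sum using (_⊎_)
open import Relation.Nullary using (¬_; yes; no)
open import Relation.Binary.PropositionalEquality using (_≡_)

-- Carrier of a q-matroid with m skew classes:
--   U = Fin m × Fin q, skew class i is {(i , j) | j : Fin q}.
-- A subtransversal picks at most one element from each skew class.
Subtrans : ℕ → ℕ → Set
Subtrans m q = Vec (Maybe (Fin q)) m

Transversal : ℕ → ℕ → Set
Transversal m q = Vec (Fin q) m

toSub : ∀ {m q} → Transversal m q → Subtrans m q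
toSub = map just

size : ∀ {m q} → Subtrans m q → ℕ
size [] = 0
size (nothing ∷ s) = size s
size (just _ ∷ s) = suc (size s)

_⊆_ : ∀ {m q} → Subtrans m q → Subtrans m q → Set
S ⊆ S' = ∀ i j → lookup S i ≡ just j → lookup S' i ≡ just j

-- union and intersection (used only for subtransversals inside a common transversal)
∪M : ∀ {q} → Maybe (Fin q) → Maybe (Fin q) → Maybe (Fin q)
∪M (just a) _ = just a
∪M nothing b = b

∩M : ∀ {q} → Maybe (Fin q) → Maybe (Fin q) → Maybe (Fin q)
∩M (just a) (just b) with a ≟F b
... | yes _ = just a
... | no _ = nothing
∩M _ _ = nothing

_∪_ : ∀ {m q} → Subtrans m q → Subtrans m q → Subtrans m q
S ∪ S' = tabulate (λ i → ∪M (lookup S i) (lookup S' i))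

_∩_ : ∀ {m q} → Subtrans m q → Subtrans m q → Subtrans m q
S ∩ S' = tabulate (λ i → ∩M (lookup S i) (lookup S' i))

-- S with element (i , j) added (used when class i is disjoint from S)
add : ∀ {m q} → Subtrans m q → Fin m → Fin q → Subtrans m q
add S i j = S [ i ]≔ just j

record IsMatroidRankOn {m q} (r : Subtrans m q → ℕ) (T : Transversal m q) : Set where
  field
    bounded   : ∀ S → S ⊆ toSub T → r S ≤ size S
    monotone  : ∀ S S' → S ⊆ S' → S' ⊆ toSub T → r S ≤ r S'
    submod    : ∀ S S' → S ⊆ toSub T → S' ⊆ toSub T →
                r (S ∪ S') + r (S ∩ S') ≤ r S + r S'

record QMatroid (m q : ℕ) : Set where
  field
    r  : Subtrans m q → ℕ
    R1 : ∀ (T : Transversal m q) → IsMatroidRankOn r T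
    -- (R2): r(S ∪ x) + r(S ∪ y) - 2 r(S) ≥ 1, written additively in ℕ
    R2 : ∀ (S : Subtrans m q) (i : Fin m) (x y : Fin q) →
         lookup S i ≡ nothing → ¬ (x ≡ y) →
         1 + (r S + r S) ≤ r (add S i x) + r (add S i y)

module _ {m q : ℕ} (Z : QMatroid m q) where
  open QMatroid Z

  nul : Subtrans m q → ℕ
  nul S = size S ∸ r S

  IsBasis : Subtrans m q → Set
  IsBasis B = nul B ≡ 0 × (∀ S → B ⊆ S → nul S ≡ 0 → S ≡ B)

  IsCircuit : Subtrans m q → Set
  IsCircuit C = 0 < nul C × (∀ C' → C' ⊆ C → 0 < nul C' → C' ≡ C)

  InBω : Subtrans m q → Fin m → Subtrans m q → Set
  InBω B ω C = ∀ i j → lookup C i ≡ just j → (lookup B i ≡ just j ⊎ i ≡ ω)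

  module _ (_≺_ : Fin m → Fin m → Set) where

    MinIn : Subtrans m q → Fin m → Set
    MinIn C ω = ¬ (lookup C ω ≡ nothing) ×
                (∀ i → ¬ (lookup C i ≡ nothing) → ¬ (i ≡ ω) → ω ≺ i)

    -- the circuit C(B,ω) (the unique circuit in B ∪ ω) exists and min C(B,ω) ∈ ω
    ActiveCircuit : Subtrans m q → Fin m → Subtrans m q → Set
    ActiveCircuit B ω C = IsCircuit C × InBω B ω C × MinIn C ω

    Active : Subtrans m q → Fin m → Set
    Active B ω = ∃ λ C → ActiveCircuit B ω C

    InActB : Subtrans m q → Fin m → Fin q → Set
    InActB B ω j = Active B ω × lookup B ω ≡ just j

    InActUnder : Subtrans m q → Fin m → Fin q → Set
    InActUnder B ω j = ∃ λ C → ActiveCircuit B ω C × lookup C ω ≡ just j ×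
                               ¬ (lookup B ω ≡ just j)

    -- T ∈ H_Z(B) :
    --  B - {B_ω : ω active} ⊆ T ⊆ B ∪ {B̲_ω : ω active}
    InH : Subtrans m q → Transversal m q → Set
    InH B T =
      (∀ i j → lookup B i ≡ just j → ¬ InActB B i j → lookup T i ≡ j) ×
      (∀ i → lookup B i ≡ just (lookup T i) ⊎ InActUnder B i (lookup T i))

{-# OPTIONS --safe #-}
-- The bases B with T ∈ H_Z(B) can be built one skew class at a time, from the ≺-largest class down.
-- Once the part P of B above ω is fixed, T ∈ H_Z(B) dictates B_ω: if T_ω is not a loop over P then
-- ω is inactive and B_ω = T_ω, while if it is, ω is active with B̲_ω = T_ω and B_ω may be any of the
-- q − 1 other elements of ω, each a coloop over P by (R2). Counting the leaves of this choice tree,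
-- a loop raises the nullity of P completed by T by one and a coloop leaves it unchanged, so there
-- are (q − 1)^n(T) of them.
module Submission where

open import Defs
open import Data.Bool using (if_then_else_)
open import Data.Fin using (Fin; zero; suc; punchIn; _≟_)
open import Data.Fin.Properties using (punchIn-injective; punchInᵢ≢i; punchIn-punchOut)
open import Data.List using (List; []; _∷_; length; allFin; concatMap) renaming (map to mapL)
open import Data.List.Properties using (length-++; length-map; length-tabulate)
open import Data.List.Membership.Propositional using (_∈_; _∉_; find; lose)
open import Data.List.Membership.Propositional.Properties using (∈-allFin; ∈-map⁺; ∈-map⁻; ∈-concatMap⁺; ∈-concatMap⁻)
open import Data.List.Relation.Binary.Permutation.Propositional using (↭-sym; ↭⇒↭ₛ)
open import Data.List.Relation.Binary.Permutation.Propositional.Properties using (∈-resp-↭)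
import Data.List.Relation.Binary.Permutation.Setoid.Properties as ↭ₛ
open import Data.List.Relation.Unary.Any using (here; there)
open import Data.List.Relation.Unary.All as All using ([])
import Data.List.Relation.Unary.All.Properties as All
open import Data.List.Relation.Unary.AllPairs as AllPairs using (AllPairs; []; _∷_)
import Data.List.Relation.Unary.AllPairs.Properties as AllPairs
open import Data.List.Relation.Unary.Linked.Properties using (Linked⇒AllPairs)
open import Data.List.Relation.Unary.Unique.Propositional using (Unique)
import Data.List.Relation.Unary.Unique.Propositional.Properties as Unique
import Data.List.Sort as Sort
open import Data.Maybe using (Maybe; just; nothing; fromMaybe; maybe′)
open import Data.Maybe.Properties using (just-injective)
import Data.Nat as ℕ
open import Data.Nat using (ℕ; zero; suc; _+_; _*_; _∸_; _^_; _≤_; _<_; z≤n; s≤s)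
open import Data.Nat.Properties
  using ( _<?_; +-suc; +-comm; *-identityˡ; +-∸-assoc; 0∸n≡0; [m+n]∸[m+o]≡n∸o; n≤0⇒n≡0; ≤-antisym
        ; ≤-trans; ≤-reflexive; ≤∧≢⇒<; <⇒≢; ≮⇒≥; m≤m+n; +-monoʳ-≤; +-monoˡ-≤; +-cancelˡ-≤; +-cancelʳ-≤
        ; ∸-monoʳ-≤; module ≤-Reasoning )
open import Data.Product using (_×_; _,_; ∃)
open import Data.Sum using (_⊎_; inj₁; inj₂)
open import Data.Vec using (Vec; []; _∷_; lookup; tabulate; _[_]≔_)
open import Data.Vec.Properties
  using (lookup-map; lookup∘tabulate; tabulate∘lookup; tabulate-cong; lookup∘update; lookup∘update′; []≔-commutes)
open import Function using (_∘_; flip; case_of_)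
open import Function.Bundles using (_⇔_; mk⇔; Equivalence)
open import Function.Properties.Equivalence using () renaming (trans to ⇔-trans)
open import Level using (0ℓ)
open import Relation.Binary.Bundles using (DecTotalOrder)
open import Relation.Binary.Core using (Rel)
import Relation.Binary.Construct.Flip.EqAndOrd as Flip
import Relation.Binary.Construct.StrictToNonStrict as StrictToNonStrict
open import Relation.Binary.PropositionalEquality
  using (_≡_; _≢_; _≗_; refl; sym; trans; cong; cong₂; subst; subst₂; setoid; module ≡-Reasoning)
open import Relation.Binary.Structures using (IsStrictTotalOrder)
open import Relation.Nullary using (¬_; Dec; yes; no; does; contradiction)
open import Relation.Nullary.Decidable using (dec-true; dec-false)

≗-lookup⇒≡ : ∀ {A : Set} {n} {xs ys : Vec A n} → lookup xs ≗ lookup ys → xs ≡ ys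
≗-lookup⇒≡ {xs = xs} {ys} eq =
  trans (sym (tabulate∘lookup xs)) (trans (tabulate-cong eq) (tabulate∘lookup ys))

≡just⇒≢nothing : ∀ {A : Set} {a : Maybe A} {x} → a ≡ just x → a ≢ nothing
≡just⇒≢nothing refl ()

module _ {A B : Set} (f : A → List B) where

  length-concatMap-const : ∀ xs {c} → (∀ {x} → x ∈ xs → length (f x) ≡ c) →
                           length (concatMap f xs) ≡ length xs * c
  length-concatMap-const [] h = refl
  length-concatMap-const (x ∷ xs) h =
    trans (length-++ (f x)) (cong₂ _+_ (h (here refl)) (length-concatMap-const xs (h ∘ there)))

  Unique-concatMap⁺ : ∀ {xs} → Unique xs → (∀ x → Unique (f x)) →
                      (∀ {x x′ y} → y ∈ f x → y ∈ f x′ → x ≡ x′) → Unique (concatMap f xs)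
  Unique-concatMap⁺ xs! fx! separated =
    Unique.concat⁺ (All.map⁺ (All.tabulate (λ {x} _ → fx! x)))
                   (AllPairs.map⁺ {f = f} (AllPairs.map (λ x≢x′ {_} (y∈ , y∈′) → x≢x′ (separated y∈ y∈′))
                                                       xs!))

others : ∀ {n} → Fin (suc n) → List (Fin (suc n))
others t = mapL (punchIn t) (allFin _)

module _ {n} {t : Fin (suc n)} where

  ∈-others⁻ : ∀ {y} → y ∈ others t → y ≢ t
  ∈-others⁻ y∈ with ∈-map⁻ (punchIn t) y∈
  ... | x , _ , refl = punchInᵢ≢i t x

  ∈-others⁺ : ∀ {y} → y ≢ t → y ∈ others t
  ∈-others⁺ y≢t = subst (_∈ others t) (punchIn-punchOut (y≢t ∘ sym)) (∈-map⁺ (punchIn t) (∈-allFin _))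

  others-unique : Unique (others t)
  others-unique = Unique.map⁺ (punchIn-injective t _ _) (Unique.allFin⁺ n)

  length-others : length (others t) ≡ n
  length-others = trans (length-map (punchIn t) (allFin n)) (length-tabulate _)

module _ {q : ℕ} where

  ∪M-identityʳ : ∀ (a : Maybe (Fin q)) → ∪M a nothing ≡ a
  ∪M-identityʳ (just _) = refl
  ∪M-identityʳ nothing  = refl

  ∩M-idem : ∀ (a : Fin q) → ∩M (just a) (just a) ≡ just a
  ∩M-idem a with a ≟ a
  ... | yes _  = refl
  ... | no a≢a = contradiction refl a≢a

  size-add : ∀ {n} (S : Vec (Maybe (Fin q)) n) i x → lookup S i ≡ nothing → size (add S i x) ≡ suc (size S)
  size-add (nothing ∷ S) zero    x _ = refl
  size-add (nothing ∷ S) (suc i) x e = size-add S i x e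
  size-add (just _ ∷ S)  (suc i) x e = cong suc (size-add S i x e)

  size-∪ : ∀ {n} (S S′ : Vec (Maybe (Fin q)) n) →
           (∀ i → lookup S i ≡ nothing ⊎ lookup S′ i ≡ nothing) → size (S ∪ S′) ≡ size S + size S′
  size-∪ []            []             _ = refl
  size-∪ (nothing ∷ S) (nothing ∷ S′) h = size-∪ S S′ (h ∘ suc)
  size-∪ (nothing ∷ S) (just _ ∷ S′)  h =
    trans (cong suc (size-∪ S S′ (h ∘ suc))) (sym (+-suc (size S) (size S′)))
  size-∪ (just _ ∷ S)  (nothing ∷ S′) h = cong suc (size-∪ S S′ (h ∘ suc))
  size-∪ (just _ ∷ S)  (just _ ∷ S′)  h with h zero
  ... | inj₁ ()
  ... | inj₂ ()

  empty : ∀ {n} → Vec (Maybe (Fin q)) n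
  empty = tabulate (λ _ → nothing)

  size-empty : ∀ {n} → size (empty {n}) ≡ 0
  size-empty {zero}  = refl
  size-empty {suc n} = size-empty {n}

module _ {m q : ℕ} where

  lookup-add : ∀ (S : Subtrans m q) i x → lookup (add S i x) i ≡ just x
  lookup-add S i x = lookup∘update i S (just x)

  lookup-add-≢ : ∀ (S : Subtrans m q) {i j} x → j ≢ i → lookup (add S i x) j ≡ lookup S j
  lookup-add-≢ S x j≢i = lookup∘update′ j≢i S (just x)

  lookup-add⁻ : ∀ (S : Subtrans m q) {i l x j} → lookup (add S i x) l ≡ just j →
                (l ≡ i × j ≡ x) ⊎ (l ≢ i × lookup S l ≡ just j)
  lookup-add⁻ S {i} {l} {x} e with l ≟ i
  ... | yes refl = inj₁ (refl , just-injective (trans (sym e) (lookup-add S l x)))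
  ... | no l≢i   = inj₂ (l≢i , trans (sym (lookup-add-≢ S x l≢i)) e)

  IsTransversal : Subtrans m q → Set
  IsTransversal S = ∀ i → lookup S i ≢ nothing

  transversal-lookup : ∀ {S : Subtrans m q} → IsTransversal S → ∀ i → ∃ λ y → lookup S i ≡ just y
  transversal-lookup {S} S-total i with lookup S i in Sᵢ≡
  ... | just y  = y , refl
  ... | nothing = contradiction Sᵢ≡ (S-total i)

  ⊆-refl : ∀ {S : Subtrans m q} → S ⊆ S
  ⊆-refl _ _ e = e

  ⊆-trans : ∀ {S S′ S″ : Subtrans m q} → S ⊆ S′ → S′ ⊆ S″ → S ⊆ S″
  ⊆-trans S⊆S′ S′⊆S″ i j = S′⊆S″ i j ∘ S⊆S′ i j

  ⊆-free : ∀ {S S′ : Subtrans m q} → S ⊆ S′ → ∀ {i} → lookup S′ i ≡ nothing → lookup S i ≡ nothing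
  ⊆-free {S} S⊆S′ {i} S′ᵢ≡nothing with lookup S i in Sᵢ≡
  ... | nothing = refl
  ... | just j with () ← trans (sym (S⊆S′ i j Sᵢ≡)) S′ᵢ≡nothing

  ⊆-add : ∀ (S : Subtrans m q) i x → lookup S i ≡ nothing → S ⊆ add S i x
  ⊆-add S i x Sᵢ≡nothing l j e with l ≟ i
  ... | yes refl with () ← trans (sym Sᵢ≡nothing) e
  ... | no l≢i = trans (lookup-add-≢ S x l≢i) e

  add-⊆ : ∀ {S S′ : Subtrans m q} {i x} → lookup S′ i ≡ just x → S ⊆ S′ → add S i x ⊆ S′
  add-⊆ {S} {i = i} {x} S′ᵢ≡x S⊆S′ l j e with l ≟ i
  ... | yes refl = trans S′ᵢ≡x (trans (sym (lookup-add S l x)) e)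
  ... | no l≢i = S⊆S′ l j (trans (sym (lookup-add-≢ S x l≢i)) e)

  lookup-empty : ∀ i → lookup (empty {q} {m}) i ≡ nothing
  lookup-empty = lookup∘tabulate _

  empty-⊆ : ∀ (S : Subtrans m q) → empty ⊆ S
  empty-⊆ S i j e = contradiction (lookup-empty i) (≡just⇒≢nothing e)

  remove : Subtrans m q → Fin m → Subtrans m q
  remove S i = S [ i ]≔ nothing

  ⊆-remove : ∀ {S S′ : Subtrans m q} {i} → lookup S i ≡ nothing → S ⊆ S′ → S ⊆ remove S′ i
  ⊆-remove {S′ = S′} {i} Sᵢ≡nothing S⊆S′ l j e with l ≟ i
  ... | yes refl with () ← trans (sym Sᵢ≡nothing) e
  ... | no l≢i = trans (lookup∘update′ l≢i S′ nothing) (S⊆S′ l j e)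

  remove-⊆ : ∀ (S : Subtrans m q) i → remove S i ⊆ S
  remove-⊆ S i l j e with l ≟ i
  ... | yes refl with () ← trans (sym e) (lookup∘update l S nothing)
  ... | no l≢i = trans (sym (lookup∘update′ l≢i S nothing)) e

  lookup-remove : ∀ (S : Subtrans m q) i → lookup (remove S i) i ≡ nothing
  lookup-remove S i = lookup∘update i S nothing

  _∖_ : Subtrans m q → Subtrans m q → Subtrans m q
  S′ ∖ S = tabulate (λ i → maybe′ (λ _ → nothing) (lookup S′ i) (lookup S i))

  lookup-∖ : ∀ (S′ S : Subtrans m q) i →
             lookup (S′ ∖ S) i ≡ maybe′ (λ _ → nothing) (lookup S′ i) (lookup S i)
  lookup-∖ S′ S = lookup∘tabulate _

  lookup-∪ : ∀ (S S′ : Subtrans m q) i → lookup (S ∪ S′) i ≡ ∪M (lookup S i) (lookup S′ i)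
  lookup-∪ S S′ = lookup∘tabulate _

  lookup-∩ : ∀ (S S′ : Subtrans m q) i → lookup (S ∩ S′) i ≡ ∩M (lookup S i) (lookup S′ i)
  lookup-∩ S S′ = lookup∘tabulate _


module Rank {m q : ℕ} (Z : QMatroid m (suc q)) where
  open QMatroid Z

  Independent : Subtrans m (suc q) → Set
  Independent S = nul Z S ≡ 0

  Loop Coloop : Subtrans m (suc q) → Fin m → Fin (suc q) → Set
  Loop   S i x = r (add S i x) ≡ r S
  Coloop S i x = r (add S i x) ≡ suc (r S)

  loop? : ∀ S i x → Dec (Loop S i x)
  loop? S i x = r (add S i x) ℕ.≟ r S

  -- (R1) only speaks about subsets of a transversal; every subtransversal lies in one.
  extend : Subtrans m (suc q) → Transversal m (suc q)
  extend S = tabulate (λ i → fromMaybe zero (lookup S i))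

  ⊆-extend : ∀ S → S ⊆ toSub (extend S)
  ⊆-extend S i j Sᵢ≡j =
    trans (lookup-map i just (extend S)) (cong just (trans (lookup∘tabulate _ i) (cong (fromMaybe zero) Sᵢ≡j)))

  r-bounded : ∀ S → r S ≤ size S
  r-bounded S = IsMatroidRankOn.bounded (R1 (extend S)) S (⊆-extend S)

  r-mono : ∀ {S S′} → S ⊆ S′ → r S ≤ r S′
  r-mono {S} {S′} S⊆S′ = IsMatroidRankOn.monotone (R1 (extend S′)) S S′ S⊆S′ (⊆-extend S′)

  r-submod : ∀ {S S′} U → S ⊆ U → S′ ⊆ U → r (S ∪ S′) + r (S ∩ S′) ≤ r S + r S′
  r-submod {S} {S′} U S⊆U S′⊆U = IsMatroidRankOn.submod (R1 (extend U)) S S′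
    (⊆-trans {S = S} {U} {toSub (extend U)} S⊆U (⊆-extend U))
    (⊆-trans {S = S′} {U} {toSub (extend U)} S′⊆U (⊆-extend U))

  r-∪≤ : ∀ {S S′} U → S ⊆ U → S′ ⊆ U → r (S ∪ S′) ≤ r S + r S′
  r-∪≤ U S⊆U S′⊆U = ≤-trans (m≤m+n _ _) (r-submod U S⊆U S′⊆U)

  r-add≤ : ∀ {S i} x → lookup S i ≡ nothing → r (add S i x) ≤ suc (r S)
  r-add≤ {S} {i} x Sᵢ≡nothing = begin
    r (add S i x)          ≡⟨ cong r (sym S∪single≡add) ⟩
    r (S ∪ single)         ≤⟨ r-∪≤ (add S i x) (⊆-add S i x Sᵢ≡nothing) single⊆add ⟩
    r S + r single         ≤⟨ +-monoʳ-≤ (r S) r-single≤1 ⟩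
    r S + 1                ≡⟨ +-comm (r S) 1 ⟩
    suc (r S)              ∎
    where
    open ≤-Reasoning
    single : Subtrans m (suc q)
    single = add empty i x
    r-single≤1 : r single ≤ 1
    r-single≤1 = ≤-trans (r-bounded single)
      (≤-reflexive (trans (size-add empty i x (lookup-empty i)) (cong suc (size-empty {n = m}))))
    single⊆add : single ⊆ add S i x
    single⊆add = add-⊆ {S = empty} {S′ = add S i x} (lookup-add S i x) (empty-⊆ (add S i x))
    S∪single≡add : S ∪ single ≡ add S i x
    S∪single≡add = ≗-lookup⇒≡ λ l → trans (lookup-∪ S single l) (pointwise l)
      where
      pointwise : ∀ l → ∪M (lookup S l) (lookup single l) ≡ lookup (add S i x) l
      pointwise l with l ≟ i
      ... | yes refl = trans (cong₂ ∪M Sᵢ≡nothing (lookup-add empty l x)) (sym (lookup-add S l x))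
      ... | no l≢i = trans (cong (∪M (lookup S l)) (trans (lookup-add-≢ empty x l≢i) (lookup-empty l)))
                           (trans (∪M-identityʳ (lookup S l)) (sym (lookup-add-≢ S x l≢i)))

  nul-mono : ∀ {S S′} → S ⊆ S′ → nul Z S ≤ nul Z S′
  nul-mono {S} {S′} S⊆S′ = begin
    size S ∸ r S                          ≡⟨ sym ([m+n]∸[m+o]≡n∸o (size D) (size S) (r S)) ⟩
    (size D + size S) ∸ (size D + r S)    ≡⟨ cong (_∸ (size D + r S)) (sym size-S′) ⟩
    size S′ ∸ (size D + r S)              ≤⟨ ∸-monoʳ-≤ (size S′) r-S′ ⟩
    size S′ ∸ r S′                        ∎
    where
    open ≤-Reasoning
    D : Subtrans m (suc q)
    D = S′ ∖ S
    D⊆S′ : D ⊆ S′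
    D⊆S′ i j e with lookup S i | lookup-∖ S′ S i
    ... | nothing | Dᵢ≡S′ᵢ = trans (sym Dᵢ≡S′ᵢ) e
    ... | just _  | Dᵢ≡nothing with () ← trans (sym Dᵢ≡nothing) e
    disjoint : ∀ i → lookup D i ≡ nothing ⊎ lookup S i ≡ nothing
    disjoint i with lookup S i | lookup-∖ S′ S i
    ... | nothing | _          = inj₂ refl
    ... | just _  | Dᵢ≡nothing = inj₁ Dᵢ≡nothing
    D∪S≡S′ : D ∪ S ≡ S′
    D∪S≡S′ = ≗-lookup⇒≡ λ i → trans (lookup-∪ D S i) (pointwise i)
      where
      pointwise : ∀ i → ∪M (lookup D i) (lookup S i) ≡ lookup S′ i
      pointwise i with lookup S i in Sᵢ≡ | lookup-∖ S′ S i
      ... | nothing | Dᵢ≡S′ᵢ     = trans (∪M-identityʳ _) Dᵢ≡S′ᵢ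
      ... | just j  | Dᵢ≡nothing rewrite Dᵢ≡nothing = sym (S⊆S′ i j Sᵢ≡)
    size-S′ : size S′ ≡ size D + size S
    size-S′ = trans (cong size (sym D∪S≡S′)) (size-∪ D S disjoint)
    r-S′ : r S′ ≤ size D + r S
    r-S′ = begin
      r S′          ≡⟨ cong r (sym D∪S≡S′) ⟩
      r (D ∪ S)     ≤⟨ r-∪≤ S′ D⊆S′ S⊆S′ ⟩
      r D + r S     ≤⟨ +-monoˡ-≤ (r S) (r-bounded D) ⟩
      size D + r S  ∎

  independent-⊆ : ∀ {S S′} → S ⊆ S′ → Independent S′ → Independent S
  independent-⊆ S⊆S′ S′-ind = n≤0⇒n≡0 (≤-trans (nul-mono S⊆S′) (≤-reflexive S′-ind))

  empty-independent : Independent empty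
  empty-independent = trans (cong (_∸ r empty) (size-empty {n = m})) (0∸n≡0 (r empty))

  nul-add-loop : ∀ {S i x} → lookup S i ≡ nothing → Loop S i x → nul Z (add S i x) ≡ suc (nul Z S)
  nul-add-loop {S} {i} {x} Sᵢ≡nothing loop =
    trans (cong₂ _∸_ (size-add S i x Sᵢ≡nothing) loop) (+-∸-assoc 1 (r-bounded S))

  nul-add-coloop : ∀ {S i x} → lookup S i ≡ nothing → Coloop S i x → nul Z (add S i x) ≡ nul Z S
  nul-add-coloop {S} {i} {x} Sᵢ≡nothing coloop = cong₂ _∸_ (size-add S i x Sᵢ≡nothing) coloop

  add-coloop-independent : ∀ {S i x} → lookup S i ≡ nothing → Coloop S i x →
                           Independent S → Independent (add S i x)
  add-coloop-independent Sᵢ≡nothing coloop S-ind = trans (nul-add-coloop Sᵢ≡nothing coloop) S-ind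

  ¬loop⇒coloop : ∀ {S i x} → lookup S i ≡ nothing → ¬ Loop S i x → Coloop S i x
  ¬loop⇒coloop {S} {i} {x} Sᵢ≡nothing ¬loop =
    ≤-antisym (r-add≤ x Sᵢ≡nothing)
              (≤∧≢⇒< (r-mono {S} {add S i x} (⊆-add S i x Sᵢ≡nothing)) (¬loop ∘ sym))

  loop⇒coloop : ∀ {S i x y} → lookup S i ≡ nothing → x ≢ y → Loop S i x → Coloop S i y
  loop⇒coloop {S} {i} {x} {y} Sᵢ≡nothing x≢y loop =
    ≤-antisym (r-add≤ y Sᵢ≡nothing) (+-cancelˡ-≤ (r S) _ _ 2r+1≤)
    where
    2r+1≤ : r S + suc (r S) ≤ r S + r (add S i y)
    2r+1≤ = subst₂ _≤_ (sym (+-suc (r S) (r S))) (cong (_+ r (add S i y)) loop) (R2 S i x y Sᵢ≡nothing x≢y)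

  dependent-add⇒loop : ∀ {S i x} → lookup S i ≡ nothing → Independent S →
                       0 < nul Z (add S i x) → Loop S i x
  dependent-add⇒loop {S} {i} {x} Sᵢ≡nothing S-ind dependent with loop? S i x
  ... | yes loop  = loop
  ... | no  ¬loop = contradiction (add-coloop-independent Sᵢ≡nothing (¬loop⇒coloop Sᵢ≡nothing ¬loop) S-ind)
                                  (<⇒≢ dependent ∘ sym)

  independent-add⇒¬loop : ∀ {S i x} → lookup S i ≡ nothing → Independent (add S i x) → ¬ Loop S i x
  independent-add⇒¬loop Sᵢ≡nothing add-ind loop =
    contradiction (trans (sym (nul-add-loop Sᵢ≡nothing loop)) add-ind) λ ()

  -- Submodularity for S and add P w x, whose union is add S w x and whose intersection contains P.
  loop-⊆ : ∀ {P S w x} → P ⊆ S → lookup P w ≡ nothing → lookup S w ≡ nothing → Loop P w x → Loop S w x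
  loop-⊆ {P} {S} {w} {x} P⊆S Pw≡nothing Sw≡nothing loop =
    ≤-antisym (+-cancelʳ-≤ (r P) (r (add S w x)) (r S) r-add+r≤)
              (r-mono {S} {add S w x} (⊆-add S w x Sw≡nothing))
    where
    open ≤-Reasoning
    S∪Px≡Sx : S ∪ add P w x ≡ add S w x
    S∪Px≡Sx = ≗-lookup⇒≡ λ i → trans (lookup-∪ S (add P w x) i) (pointwise i)
      where
      pointwise : ∀ i → ∪M (lookup S i) (lookup (add P w x) i) ≡ lookup (add S w x) i
      pointwise i with i ≟ w
      ... | yes refl = trans (cong₂ ∪M Sw≡nothing (lookup-add P i x)) (sym (lookup-add S i x))
      ... | no i≢w rewrite lookup-add-≢ S x i≢w | lookup-add-≢ P x i≢w with lookup S i in Sᵢ≡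
      ...   | just _  = refl
      ...   | nothing = ⊆-free {S = P} {S} P⊆S Sᵢ≡
    P⊆S∩Px : P ⊆ (S ∩ add P w x)
    P⊆S∩Px i j Pᵢ≡j with i ≟ w
    ... | yes refl with () ← trans (sym Pᵢ≡j) Pw≡nothing
    ... | no i≢w = trans (lookup-∩ S (add P w x) i)
                         (trans (cong₂ ∩M (P⊆S i j Pᵢ≡j) (trans (lookup-add-≢ P x i≢w) Pᵢ≡j)) (∩M-idem j))
    Px⊆Sx : add P w x ⊆ add S w x
    Px⊆Sx = add-⊆ {S = P} {add S w x} (lookup-add S w x)
                  (⊆-trans {S = P} {S} {add S w x} P⊆S (⊆-add S w x Sw≡nothing))
    r-add+r≤ : r (add S w x) + r P ≤ r S + r P
    r-add+r≤ = begin
      r (add S w x) + r P                         ≤⟨ +-monoʳ-≤ (r (add S w x)) (r-mono {P} {S ∩ add P w x} P⊆S∩Px) ⟩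
      r (add S w x) + r (S ∩ add P w x)           ≡⟨ cong (λ U → r U + r (S ∩ add P w x)) (sym S∪Px≡Sx) ⟩
      r (S ∪ add P w x) + r (S ∩ add P w x)       ≤⟨ r-submod (add S w x) (⊆-add S w x Sw≡nothing) Px⊆Sx ⟩
      r S + r (add P w x)                         ≡⟨ cong (r S +_) loop ⟩
      r S + r P                                   ∎

  deletions-independent⇒circuit : ∀ {C} → 0 < nul Z C →
    (∀ i → lookup C i ≡ nothing ⊎ Independent (remove C i)) → IsCircuit Z C
  deletions-independent⇒circuit {C} C-dep deletions = C-dep , minimal
    where
    minimal : ∀ C′ → C′ ⊆ C → 0 < nul Z C′ → C′ ≡ C
    minimal C′ C′⊆C C′-dep = ≗-lookup⇒≡ pointwise
      where
      pointwise : ∀ i → lookup C′ i ≡ lookup C i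
      pointwise i with lookup C′ i in C′ᵢ≡
      ... | just j  = sym (C′⊆C i j C′ᵢ≡)
      ... | nothing with deletions i
      ...   | inj₁ Cᵢ≡nothing = sym Cᵢ≡nothing
      ...   | inj₂ C-i-ind =
        contradiction (independent-⊆ {C′} {remove C i} (⊆-remove {S = C′} {C} C′ᵢ≡ C′⊆C) C-i-ind)
                      (<⇒≢ C′-dep ∘ sym)

  prune : List (Fin m) → Subtrans m (suc q) → Subtrans m (suc q)
  prune []       D = D
  prune (i ∷ is) D with 0 <? nul Z (remove D i)
  ... | yes _ = prune is (remove D i)
  ... | no  _ = prune is D

  prune-⊆ : ∀ is D → prune is D ⊆ D
  prune-⊆ []       D = ⊆-refl {S = D}
  prune-⊆ (i ∷ is) D with 0 <? nul Z (remove D i)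
  ... | yes _ = ⊆-trans {S = prune is (remove D i)} {remove D i} {D} (prune-⊆ is (remove D i)) (remove-⊆ D i)
  ... | no  _ = prune-⊆ is D

  prune-dependent : ∀ is D → 0 < nul Z D → 0 < nul Z (prune is D)
  prune-dependent []       D D-dep = D-dep
  prune-dependent (i ∷ is) D D-dep with 0 <? nul Z (remove D i)
  ... | yes D-i-dep = prune-dependent is (remove D i) D-i-dep
  ... | no  _       = prune-dependent is D D-dep

  prune-minimal : ∀ is D {i} → i ∈ is →
                  lookup (prune is D) i ≡ nothing ⊎ Independent (remove (prune is D) i)
  prune-minimal (i ∷ is) D (here refl) with 0 <? nul Z (remove D i)
  ... | yes _ = inj₁ (⊆-free {S = prune is (remove D i)} {remove D i} (prune-⊆ is (remove D i)) (lookup-remove D i))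
  ... | no D-i-ind = inj₂ (n≤0⇒n≡0 (≤-trans (nul-mono {remove C i} {remove D i} C-i⊆D-i) (≮⇒≥ D-i-ind)))
    where
    C = prune is D
    C-i⊆D-i : remove C i ⊆ remove D i
    C-i⊆D-i = ⊆-remove {S = remove C i} {D} (lookup-remove C i)
                (⊆-trans {S = remove C i} {C} {D} (remove-⊆ C i) (prune-⊆ is D))
  prune-minimal (i′ ∷ is) D (there i∈) with 0 <? nul Z (remove D i′)
  ... | yes _ = prune-minimal is (remove D i′) i∈
  ... | no  _ = prune-minimal is D i∈

  dependent⇒⊇circuit : ∀ {D} → 0 < nul Z D → ∃ λ C → C ⊆ D × IsCircuit Z C
  dependent⇒⊇circuit {D} D-dep =
    prune (allFin m) D , prune-⊆ (allFin m) D ,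
    deletions-independent⇒circuit (prune-dependent (allFin m) D D-dep)
                                  (λ i → prune-minimal (allFin m) D (∈-allFin i))

module _ {m k : ℕ} (Z : QMatroid m (suc (suc k))) where
  open Rank Z

  free-class-has-coloop : ∀ {S i} → lookup S i ≡ nothing → ∃ λ x → Coloop S i x
  free-class-has-coloop {S} {i} Sᵢ≡nothing with loop? S i zero
  ... | yes loop  = suc zero , loop⇒coloop Sᵢ≡nothing (λ ()) loop
  ... | no  ¬loop = zero , ¬loop⇒coloop Sᵢ≡nothing ¬loop

  basis⇒transversal : ∀ {B} → IsBasis Z B → IsTransversal B
  basis⇒transversal {B} (B-ind , maximal) i Bᵢ≡nothing with free-class-has-coloop Bᵢ≡nothing
  ... | x , coloop = ≡just⇒≢nothing (trans (cong (λ S → lookup S i) (sym B+x≡B)) (lookup-add B i x)) Bᵢ≡nothing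
    where
    B+x≡B : add B i x ≡ B
    B+x≡B = maximal (add B i x) (⊆-add B i x Bᵢ≡nothing) (add-coloop-independent Bᵢ≡nothing coloop B-ind)

  independent-transversal⇒basis : ∀ {B} → Independent B → IsTransversal B → IsBasis Z B
  independent-transversal⇒basis {B} B-ind B-total = B-ind , λ S B⊆S _ → ≗-lookup⇒≡ (pointwise S B⊆S)
    where
    pointwise : ∀ S → B ⊆ S → ∀ i → lookup S i ≡ lookup B i
    pointwise S B⊆S i with lookup B i in Bᵢ≡
    ... | just j  = B⊆S i j Bᵢ≡
    ... | nothing = contradiction Bᵢ≡ (B-total i)

module Activity {m q : ℕ} (Z : QMatroid m (suc q))
                {_≺_ : Fin m → Fin m → Set} (≺-sto : IsStrictTotalOrder _≡_ _≺_) where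
  open Rank Z
  open IsStrictTotalOrder ≺-sto using () renaming (_<?_ to _≺?_)

  above : Subtrans m (suc q) → Fin m → Subtrans m (suc q)
  above B ω = tabulate (λ i → if does (ω ≺? i) then lookup B i else nothing)

  lookup-above-≻ : ∀ B {ω i} → ω ≺ i → lookup (above B ω) i ≡ lookup B i
  lookup-above-≻ B {ω} {i} ω≺i =
    trans (lookup∘tabulate _ i) (cong (if_then lookup B i else nothing) (dec-true (ω ≺? i) ω≺i))

  lookup-above-⊁ : ∀ B {ω i} → ¬ ω ≺ i → lookup (above B ω) i ≡ nothing
  lookup-above-⊁ B {ω} {i} ω⊀i =
    trans (lookup∘tabulate _ i) (cong (if_then lookup B i else nothing) (dec-false (ω ≺? i) ω⊀i))

  above-defined⇒≻ : ∀ B {ω i j} → lookup (above B ω) i ≡ just j → ω ≺ i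
  above-defined⇒≻ B {ω} {i} e with ω ≺? i
  ... | yes ω≺i = ω≺i
  ... | no  ω⊀i = contradiction (lookup-above-⊁ B ω⊀i) (≡just⇒≢nothing e)

  above-⊆ : ∀ B ω → above B ω ⊆ B
  above-⊆ B ω i j e = trans (sym (lookup-above-≻ B (above-defined⇒≻ B e))) e

  lookup-above-self : ∀ B ω → lookup (above B ω) ω ≡ nothing
  lookup-above-self B ω = lookup-above-⊁ B (IsStrictTotalOrder.irrefl ≺-sto refl)

  above-independent : ∀ {B ω} → Independent B → Independent (above B ω)
  above-independent {B} {ω} = independent-⊆ {above B ω} {B} (above-⊆ B ω)

  underline⇒loop : ∀ {B ω x} → Independent B → InActUnder Z _≺_ B ω x → Loop (above B ω) ω x
  underline⇒loop {B} {ω} {x} B-ind (C , ((C-dep , _) , C⊆B∪ω , (_ , ω-least)) , Cω≡x , _) =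
    dependent-add⇒loop (lookup-above-self B ω) (above-independent B-ind)
                       (≤-trans C-dep (nul-mono {C} {add (above B ω) ω x} C⊆A+x))
    where
    C⊆A+x : C ⊆ add (above B ω) ω x
    C⊆A+x i j Cᵢ≡j with i ≟ ω | C⊆B∪ω i j Cᵢ≡j
    ... | yes refl | _         = trans (lookup-add (above B ω) i x) (trans (sym Cω≡x) Cᵢ≡j)
    ... | no i≢ω   | inj₂ i≡ω  = contradiction i≡ω i≢ω
    ... | no i≢ω   | inj₁ Bᵢ≡j = trans (lookup-add-≢ (above B ω) x i≢ω) (trans (lookup-above-≻ B ω≺i) Bᵢ≡j)
      where
      ω≺i : ω ≺ i
      ω≺i = ω-least i (≡just⇒≢nothing Cᵢ≡j) i≢ω

  -- Any circuit inside the dependent set (above B ω) + x must use x, and all its other elements lie above ω.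
  loop⇒underline : ∀ {B ω x} → Independent B → Loop (above B ω) ω x → lookup B ω ≢ just x →
                   InActUnder Z _≺_ B ω x
  loop⇒underline {B} {ω} {x} B-ind loop Bω≢x with dependent⇒⊇circuit A+x-dep
    where
    A+x-dep : 0 < nul Z (add (above B ω) ω x)
    A+x-dep = subst (0 <_) (sym (nul-add-loop (lookup-above-self B ω) loop)) (s≤s z≤n)
  ... | C , C⊆A+x , C-circuit@(C-dep , _) = C , (C-circuit , C⊆B∪ω , Cω-defined , ω-least) , Cω≡x , Bω≢x
    where
    A = above B ω
    C⊆B∪ω : InBω Z B ω C
    C⊆B∪ω i j Cᵢ≡j with lookup-add⁻ A (C⊆A+x i j Cᵢ≡j)
    ... | inj₁ (i≡ω , _)  = inj₂ i≡ω
    ... | inj₂ (_ , Aᵢ≡j) = inj₁ (above-⊆ B ω i j Aᵢ≡j)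
    Cω-defined : lookup C ω ≢ nothing
    Cω-defined Cω≡nothing = contradiction (independent-⊆ {C} {A} C⊆A (above-independent B-ind))
                                          (<⇒≢ C-dep ∘ sym)
      where
      C⊆A : C ⊆ A
      C⊆A i j Cᵢ≡j with lookup-add⁻ A (C⊆A+x i j Cᵢ≡j)
      ... | inj₁ (refl , _) = contradiction Cω≡nothing (≡just⇒≢nothing Cᵢ≡j)
      ... | inj₂ (_ , Aᵢ≡j) = Aᵢ≡j
    ω-least : ∀ i → lookup C i ≢ nothing → i ≢ ω → ω ≺ i
    ω-least i Cᵢ-defined i≢ω with lookup C i in Cᵢ≡
    ... | nothing = contradiction refl Cᵢ-defined
    ... | just j with lookup-add⁻ A (C⊆A+x i j Cᵢ≡)
    ...   | inj₁ (i≡ω , _)  = contradiction i≡ω i≢ω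
    ...   | inj₂ (_ , Aᵢ≡j) = above-defined⇒≻ B Aᵢ≡j
    Cω≡x : lookup C ω ≡ just x
    Cω≡x with lookup C ω in Cω≡
    ... | nothing = contradiction Cω≡ Cω-defined
    ... | just j with lookup-add⁻ A (C⊆A+x ω j Cω≡)
    ...   | inj₁ (_ , j≡x)  = cong just j≡x
    ...   | inj₂ (ω≢ω , _) = contradiction refl ω≢ω

module ChoiceTree {m q : ℕ} (choices : Subtrans m q → Fin m → List (Fin q)) where

  extensions : List (Fin m) → Subtrans m q → List (Subtrans m q)
  extensions []       P = P ∷ []
  extensions (w ∷ ws) P = concatMap (λ y → extensions ws (add P w y)) (choices P w)

  Extends : List (Fin m) → Subtrans m q → Subtrans m q → Set
  Extends []       P B = B ≡ P
  Extends (w ∷ ws) P B = ∃ λ y → y ∈ choices P w × Extends ws (add P w y) B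

  ∈-extensions⁻ : ∀ ws P {B} → B ∈ extensions ws P → Extends ws P B
  ∈-extensions⁻ []       P (here B≡P) = B≡P
  ∈-extensions⁻ (w ∷ ws) P B∈ with find (∈-concatMap⁻ (λ y → extensions ws (add P w y)) B∈)
  ... | y , y∈ , B∈′ = y , y∈ , ∈-extensions⁻ ws (add P w y) B∈′

  ∈-extensions⁺ : ∀ ws P {B} → Extends ws P B → B ∈ extensions ws P
  ∈-extensions⁺ []       P B≡P              = here B≡P
  ∈-extensions⁺ (w ∷ ws) P (y , y∈ , B-ext) =
    ∈-concatMap⁺ (λ y → extensions ws (add P w y)) (lose y∈ (∈-extensions⁺ ws (add P w y) B-ext))

  Extends-outside : ∀ ws {P B i} → Extends ws P B → i ∉ ws → lookup B i ≡ lookup P i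
  Extends-outside []       refl               _  = refl
  Extends-outside (w ∷ ws) {P} {i = i} (y , _ , B-ext) i∉ with i ≟ w
  ... | yes refl = contradiction (here refl) i∉
  ... | no  i≢w  = trans (Extends-outside ws B-ext (i∉ ∘ there)) (lookup-add-≢ P y i≢w)

  extensions-unique : ∀ {ws} P → Unique ws → (∀ P w → Unique (choices P w)) → Unique (extensions ws P)
  extensions-unique {[]}     P _              _        = [] ∷ []
  extensions-unique {w ∷ ws} P (w≢ws ∷ ws!) choices! =
    Unique-concatMap⁺ _ (choices! P w) (λ y → extensions-unique (add P w y) ws! choices!) branch-determines
    where
    branch-determines : ∀ {y y′ B} → B ∈ extensions ws (add P w y) → B ∈ extensions ws (add P w y′) → y ≡ y′
    branch-determines {y} {y′} {B} B∈ B∈′ = just-injective (begin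
      just y                   ≡⟨ sym (lookup-add P w y) ⟩
      lookup (add P w y) w     ≡⟨ sym (Extends-outside ws (∈-extensions⁻ ws (add P w y) B∈) w∉ws) ⟩
      lookup B w               ≡⟨ Extends-outside ws (∈-extensions⁻ ws (add P w y′) B∈′) w∉ws ⟩
      lookup (add P w y′) w    ≡⟨ lookup-add P w y′ ⟩
      just y′                  ∎)
      where
      open ≡-Reasoning
      w∉ws : w ∉ ws
      w∉ws w∈ws = All.lookup w≢ws w∈ws refl

module DescendingEnumeration {m} {_≺_ : Rel (Fin m) 0ℓ} (≺-sto : IsStrictTotalOrder _≡_ _≺_) where

  private
    ≽-decTotalOrder : DecTotalOrder 0ℓ 0ℓ 0ℓ
    ≽-decTotalOrder = record
      { isDecTotalOrder = StrictToNonStrict.isDecTotalOrder _≡_ (flip _≺_) (Flip.isStrictTotalOrder ≺-sto) }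

    open Sort ≽-decTotalOrder using (sort; sort-↭; sort-↗)
    open DecTotalOrder ≽-decTotalOrder using () renaming (_≤_ to _≽_; trans to ≽-trans)

  descending : List (Fin m)
  descending = sort (allFin m)

  ∈-descending : ∀ w → w ∈ descending
  ∈-descending w = ∈-resp-↭ (↭-sym (sort-↭ (allFin m))) (∈-allFin w)

  descending-unique : Unique descending
  descending-unique =
    ↭ₛ.Unique-resp-↭ (setoid (Fin m)) (↭⇒↭ₛ (↭-sym (sort-↭ (allFin m)))) (Unique.allFin⁺ m)

  descending-sorted : AllPairs (flip _≺_) descending
  descending-sorted = AllPairs.zipWith strict (Linked⇒AllPairs ≽-trans (sort-↗ (allFin m)) , descending-unique)
    where
    strict : ∀ {v w} → v ≽ w × v ≢ w → w ≺ v
    strict (inj₁ w≺v , _)   = w≺v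
    strict (inj₂ v≡w , v≢w) = contradiction v≡w v≢w

module Enumeration {m k : ℕ} (Z : QMatroid m (suc (suc k)))
                   {_≺_ : Fin m → Fin m → Set} (≺-sto : IsStrictTotalOrder _≡_ _≺_)
                   (T : Transversal m (suc (suc k))) where
  open Rank Z
  open Activity Z ≺-sto
  open DescendingEnumeration ≺-sto
  open IsStrictTotalOrder ≺-sto using (irrefl; asym) renaming (_<?_ to _≺?_)

  private
    Sub : Set
    Sub = Subtrans m (suc (suc k))

  -- How T ∈ H_Z(B) constrains B_w once the part P of B above w is known.
  Admissible : Sub → Fin m → Fin (suc (suc k)) → Set
  Admissible P w y = (y ≡ lookup T w × ¬ Loop P w (lookup T w)) ⊎ (y ≢ lookup T w × Loop P w (lookup T w))

  admissible : Sub → Fin m → List (Fin (suc (suc k)))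
  admissible P w with loop? P w (lookup T w)
  ... | yes _ = others (lookup T w)
  ... | no  _ = lookup T w ∷ []

  ∈-admissible⁻ : ∀ {P w y} → y ∈ admissible P w → Admissible P w y
  ∈-admissible⁻ {P} {w} y∈ with loop? P w (lookup T w) | y∈
  ... | yes loop  | y∈others = inj₂ (∈-others⁻ y∈others , loop)
  ... | no  ¬loop | here y≡t = inj₁ (y≡t , ¬loop)

  ∈-admissible⁺ : ∀ {P w y} → Admissible P w y → y ∈ admissible P w
  ∈-admissible⁺ {P} {w} adm with loop? P w (lookup T w) | adm
  ... | yes loop  | inj₁ (_ , ¬loop) = contradiction loop ¬loop
  ... | yes _     | inj₂ (y≢t , _)   = ∈-others⁺ y≢t
  ... | no  _     | inj₁ (y≡t , _)   = here y≡t
  ... | no  ¬loop | inj₂ (_ , loop)  = contradiction loop ¬loop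

  admissible-unique : ∀ P w → Unique (admissible P w)
  admissible-unique P w with loop? P w (lookup T w)
  ... | yes _ = others-unique
  ... | no  _ = [] ∷ []

  admissible⇒coloop : ∀ {P w y} → lookup P w ≡ nothing → Admissible P w y → Coloop P w y
  admissible⇒coloop Pw≡nothing (inj₁ (refl , ¬loop)) = ¬loop⇒coloop Pw≡nothing ¬loop
  admissible⇒coloop Pw≡nothing (inj₂ (y≢t , loop))  = loop⇒coloop Pw≡nothing (y≢t ∘ sym) loop

  AdmissibleAt : Sub → Fin m → Set
  AdmissibleAt B ω = ∀ {y} → lookup B ω ≡ just y → Admissible (above B ω) ω y

  InH⇔admissible : ∀ {B} → IsBasis Z B → InH Z _≺_ B T ⇔ (∀ ω → AdmissibleAt B ω)
  InH⇔admissible {B} B-basis@(B-ind , _) =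
    mk⇔ (λ (_ , upper) → upper⇒admissible upper)
        (λ adm → upper⇒lower (admissible⇒upper adm) , admissible⇒upper adm)
    where
    Upper : Set
    Upper = ∀ i → lookup B i ≡ just (lookup T i) ⊎ InActUnder Z _≺_ B i (lookup T i)

    upper⇒admissible : Upper → ∀ ω → AdmissibleAt B ω
    upper⇒admissible upper ω {y} Bω≡y with upper ω
    ... | inj₁ Bω≡t = inj₁ (just-injective (trans (sym Bω≡y) Bω≡t) , ¬loop)
      where
      ¬loop : ¬ Loop (above B ω) ω (lookup T ω)
      ¬loop = independent-add⇒¬loop (lookup-above-self B ω)
        (independent-⊆ {add (above B ω) ω (lookup T ω)} {B}
                       (add-⊆ {S = above B ω} {B} Bω≡t (above-⊆ B ω)) B-ind)
    ... | inj₂ underline@(_ , _ , _ , Bω≢t) =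
      inj₂ ((λ y≡t → Bω≢t (trans Bω≡y (cong just y≡t))) , underline⇒loop B-ind underline)

    admissible⇒upper : (∀ ω → AdmissibleAt B ω) → Upper
    admissible⇒upper adm ω with transversal-lookup {S = B} (basis⇒transversal Z B-basis) ω
    ... | y , Bω≡ with adm ω Bω≡
    ...   | inj₁ (y≡t , _)    = inj₁ (trans Bω≡ (cong just y≡t))
    ...   | inj₂ (y≢t , loop) =
      inj₂ (loop⇒underline B-ind loop (λ Bω≡t → y≢t (just-injective (trans (sym Bω≡) Bω≡t))))

    upper⇒lower : Upper → ∀ i j → lookup B i ≡ just j → ¬ InActB Z _≺_ B i j → lookup T i ≡ j
    upper⇒lower upper i j Bᵢ≡j inactive with upper i
    ... | inj₁ Bᵢ≡t             = just-injective (trans (sym Bᵢ≡t) Bᵢ≡j)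
    ... | inj₂ (C , C-active , _) = contradiction ((C , C-active) , Bᵢ≡j) inactive

  -- P is the part of a basis lying above the skew classes ws that are still to be chosen.
  record Stage (ws : List (Fin m)) (P : Sub) : Set where
    field
      pending⇒free   : ∀ {i} → i ∈ ws → lookup P i ≡ nothing
      free⇒pending   : ∀ {i} → lookup P i ≡ nothing → i ∈ ws
      sorted         : AllPairs (flip _≺_) ws
      pending≺chosen : ∀ {w i} → w ∈ ws → lookup P i ≢ nothing → w ≺ i
      independent    : Independent P
  open Stage

  stage₀ : Stage descending empty
  stage₀ = record
    { pending⇒free   = λ {i} _ → lookup-empty i
    ; free⇒pending   = λ {i} _ → ∈-descending i
    ; sorted         = descending-sorted
    ; pending≺chosen = λ {_} {i} _ defined → contradiction (lookup-empty i) defined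
    ; independent    = empty-independent
    }

  module _ {w ws P} (st : Stage (w ∷ ws) P) where

    stage-free : lookup P w ≡ nothing
    stage-free = pending⇒free st (here refl)

    stage-∉ : w ∉ ws
    stage-∉ w∈ws with sorted st
    ... | w≻ws ∷ _ = irrefl refl (All.lookup w≻ws w∈ws)

    stage-step : ∀ {y} → Coloop P w y → Stage ws (add P w y)
    stage-step {y} coloop = record
      { pending⇒free   = pending⇒free′
      ; free⇒pending   = free⇒pending′
      ; sorted         = AllPairs.tail (sorted st)
      ; pending≺chosen = pending≺chosen′
      ; independent    = add-coloop-independent stage-free coloop (independent st)
      }
      where
      pending⇒free′ : ∀ {i} → i ∈ ws → lookup (add P w y) i ≡ nothing
      pending⇒free′ {i} i∈ws with i ≟ w
      ... | yes refl = contradiction i∈ws stage-∉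
      ... | no  i≢w  = trans (lookup-add-≢ P y i≢w) (pending⇒free st (there i∈ws))
      free⇒pending′ : ∀ {i} → lookup (add P w y) i ≡ nothing → i ∈ ws
      free⇒pending′ {i} free with i ≟ w
      ... | yes refl = contradiction free (≡just⇒≢nothing (lookup-add P i y))
      ... | no  i≢w  with free⇒pending st (trans (sym (lookup-add-≢ P y i≢w)) free)
      ...   | here i≡w   = contradiction i≡w i≢w
      ...   | there i∈ws = i∈ws
      pending≺chosen′ : ∀ {v i} → v ∈ ws → lookup (add P w y) i ≢ nothing → v ≺ i
      pending≺chosen′ {v} {i} v∈ws defined with i ≟ w | sorted st
      ... | yes refl | w≻ws ∷ _ = All.lookup w≻ws v∈ws
      ... | no  i≢w  | _        = pending≺chosen st (there v∈ws) (defined ∘ trans (lookup-add-≢ P y i≢w))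

    above-stage : ∀ {B} → P ⊆ B → above B w ≡ P
    above-stage {B} P⊆B = ≗-lookup⇒≡ pointwise
      where
      pointwise : ∀ i → lookup (above B w) i ≡ lookup P i
      pointwise i with w ≺? i | lookup P i in Pᵢ≡
      ... | yes w≺i | just j  = trans (lookup-above-≻ B w≺i) (P⊆B i j Pᵢ≡)
      ... | no  w⊀i | nothing = lookup-above-⊁ B w⊀i
      ... | no  w⊀i | just j  = contradiction (pending≺chosen st (here refl) (≡just⇒≢nothing Pᵢ≡)) w⊀i
      ... | yes w≺i | nothing with free⇒pending st Pᵢ≡ | sorted st
      ...   | here refl   | _          = contradiction w≺i (irrefl refl)
      ...   | there i∈ws  | w≻ws ∷ _   = contradiction w≺i (asym (All.lookup w≻ws i∈ws))

  open ChoiceTree admissible public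

  AdmissibleAlong : List (Fin m) → Sub → Set
  AdmissibleAlong ws B = ∀ {ω} → ω ∈ ws → AdmissibleAt B ω

  extends⇒admissible : ∀ {ws P B} → Stage ws P → Extends ws P B →
                       Independent B × IsTransversal B × P ⊆ B × AdmissibleAlong ws B
  extends⇒admissible {[]} {P} st refl =
    independent st , (λ i free → case free⇒pending st free of λ ()) , ⊆-refl {S = P} , λ ()
  extends⇒admissible {w ∷ ws} {P} {B} st (y , y∈ , B-ext)
    with extends⇒admissible (stage-step st (admissible⇒coloop (stage-free st) (∈-admissible⁻ y∈))) B-ext
  ... | B-ind , B-total , P+y⊆B , adm = B-ind , B-total , P⊆B , adm′
    where
    P⊆B : P ⊆ B
    P⊆B = ⊆-trans {S = P} {add P w y} {B} (⊆-add P w y (stage-free st)) P+y⊆B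
    adm′ : AdmissibleAlong (w ∷ ws) B
    adm′ (here refl) Bw≡y′ with trans (sym (P+y⊆B w y (lookup-add P w y))) Bw≡y′
    ... | refl = subst (λ A → Admissible A w y) (sym (above-stage st {B} P⊆B)) (∈-admissible⁻ y∈)
    adm′ (there ω∈ws) = adm ω∈ws

  admissible⇒extends : ∀ {ws P B} → Stage ws P → P ⊆ B → IsTransversal B → AdmissibleAlong ws B →
                       Extends ws P B
  admissible⇒extends {[]} {P} {B} st P⊆B B-total _ = ≗-lookup⇒≡ pointwise
    where
    pointwise : ∀ i → lookup B i ≡ lookup P i
    pointwise i with lookup P i in Pᵢ≡
    ... | just j  = P⊆B i j Pᵢ≡
    ... | nothing = case free⇒pending st Pᵢ≡ of λ ()
  admissible⇒extends {w ∷ ws} {P} {B} st P⊆B B-total adm with transversal-lookup {S = B} B-total w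
  ... | y , Bw≡y = y , ∈-admissible⁺ y-admissible ,
                   admissible⇒extends (stage-step st (admissible⇒coloop (stage-free st) y-admissible))
                                      (add-⊆ {S = P} {B} Bw≡y P⊆B) B-total (adm ∘ there)
    where
    y-admissible : Admissible P w y
    y-admissible = subst (λ A → Admissible A w y) (above-stage st {B} P⊆B) (adm (here refl) Bw≡y)

  fillWithT : List (Fin m) → Sub → Sub
  fillWithT []       P = P
  fillWithT (w ∷ ws) P = add (fillWithT ws P) w (lookup T w)

  lookup-fillWithT-∉ : ∀ ws {P i} → i ∉ ws → lookup (fillWithT ws P) i ≡ lookup P i
  lookup-fillWithT-∉ []       _  = refl
  lookup-fillWithT-∉ (w ∷ ws) {P} {i} i∉ with i ≟ w
  ... | yes refl = contradiction (here refl) i∉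
  ... | no  i≢w  = trans (lookup-add-≢ (fillWithT ws P) (lookup T w) i≢w) (lookup-fillWithT-∉ ws (i∉ ∘ there))

  lookup-fillWithT-∈ : ∀ ws {P i} → i ∈ ws → lookup (fillWithT ws P) i ≡ just (lookup T i)
  lookup-fillWithT-∈ (w ∷ ws) {P} {i} i∈ with i ≟ w | i∈
  ... | yes refl | _          = lookup-add (fillWithT ws P) i (lookup T i)
  ... | no  i≢w  | here i≡w   = contradiction i≡w i≢w
  ... | no  i≢w  | there i∈ws =
    trans (lookup-add-≢ (fillWithT ws P) (lookup T w) i≢w) (lookup-fillWithT-∈ ws i∈ws)

  fillWithT-add : ∀ ws {P w z} → w ∉ ws → fillWithT ws (add P w z) ≡ add (fillWithT ws P) w z
  fillWithT-add []        _  = refl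
  fillWithT-add (w′ ∷ ws) {P} {w} {z} w∉ = begin
    add (fillWithT ws (add P w z)) w′ t′  ≡⟨ cong (λ S → add S w′ t′) (fillWithT-add ws (w∉ ∘ there)) ⟩
    add (add (fillWithT ws P) w z) w′ t′  ≡⟨ []≔-commutes (fillWithT ws P) w w′ (w∉ ∘ here) ⟩
    add (add (fillWithT ws P) w′ t′) w z  ∎
    where
    open ≡-Reasoning
    t′ = lookup T w′

  ⊆-fillWithT : ∀ ws {P} → (∀ {i} → i ∈ ws → lookup P i ≡ nothing) → P ⊆ fillWithT ws P
  ⊆-fillWithT []       {P} _    = ⊆-refl {S = P}
  ⊆-fillWithT (w ∷ ws) {P} free i j Pᵢ≡j with i ≟ w
  ... | yes refl = contradiction (free (here refl)) (≡just⇒≢nothing Pᵢ≡j)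
  ... | no  i≢w  =
    trans (lookup-add-≢ (fillWithT ws P) (lookup T w) i≢w) (⊆-fillWithT ws (free ∘ there) i j Pᵢ≡j)

  fillWithT-descending : fillWithT descending empty ≡ toSub T
  fillWithT-descending = ≗-lookup⇒≡ λ i →
    trans (lookup-fillWithT-∈ descending (∈-descending i)) (sym (lookup-map i just T))

  module _ {w ws P} (st : Stage (w ∷ ws) P) where
    private
      t = lookup T w
      S = fillWithT ws P

      Sw≡nothing : lookup S w ≡ nothing
      Sw≡nothing = trans (lookup-fillWithT-∉ ws (stage-∉ st)) (stage-free st)

      P⊆S : P ⊆ S
      P⊆S = ⊆-fillWithT ws (pending⇒free st ∘ there)

    -- In the loop case t stays a loop over the larger S, so the exponent on the right is nul S + 1,
    -- while each of the q − 1 branches (all coloops over S) contributes suc k ^ nul S.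
    length-extensions-step :
      (∀ {y} → Coloop P w y → length (extensions ws (add P w y)) ≡ suc k ^ nul Z (add S w y)) →
      length (extensions (w ∷ ws) P) ≡ suc k ^ nul Z (fillWithT (w ∷ ws) P)
    length-extensions-step branch-length with loop? P w t
    ... | no ¬loop = begin
      length (concatMap branch (t ∷ []))  ≡⟨ length-concatMap-const branch (t ∷ [])
                                               (λ { (here refl) → branch-length (¬loop⇒coloop (stage-free st) ¬loop) }) ⟩
      1 * suc k ^ nul Z (add S w t)       ≡⟨ *-identityˡ _ ⟩
      suc k ^ nul Z (add S w t)           ∎
      where
      open ≡-Reasoning
      branch = λ y → extensions ws (add P w y)
    ... | yes loop = begin
      length (concatMap branch (others t))  ≡⟨ length-concatMap-const branch (others t) branch-length′ ⟩
      length (others t) * suc k ^ nul Z S   ≡⟨ cong (_* suc k ^ nul Z S) (length-others {t = t}) ⟩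
      suc k ^ suc (nul Z S)                 ≡⟨ cong (suc k ^_) (sym (nul-add-loop Sw≡nothing loopS)) ⟩
      suc k ^ nul Z (add S w t)             ∎
      where
      open ≡-Reasoning
      branch = λ y → extensions ws (add P w y)
      loopS : Loop S w t
      loopS = loop-⊆ {P} {S} P⊆S (stage-free st) Sw≡nothing loop
      branch-length′ : ∀ {y} → y ∈ others t → length (branch y) ≡ suc k ^ nul Z S
      branch-length′ y∈ = trans (branch-length (loop⇒coloop (stage-free st) (∈-others⁻ y∈ ∘ sym) loop))
        (cong (suc k ^_) (nul-add-coloop Sw≡nothing (loop⇒coloop Sw≡nothing (∈-others⁻ y∈ ∘ sym) loopS)))

  length-extensions : ∀ {ws P} → Stage ws P → length (extensions ws P) ≡ suc k ^ nul Z (fillWithT ws P)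
  length-extensions {[]}     st = cong (suc k ^_) (sym (independent st))
  length-extensions {w ∷ ws} st = length-extensions-step st λ coloop →
    trans (length-extensions (stage-step st coloop)) (cong (λ U → suc k ^ nul Z U) (fillWithT-add ws (stage-∉ st)))

  extends⇔basis∧InH : ∀ {B} → Extends descending empty B ⇔ (IsBasis Z B × InH Z _≺_ B T)
  extends⇔basis∧InH {B} = mk⇔ to from
    where
    to : Extends descending empty B → IsBasis Z B × InH Z _≺_ B T
    to B-ext with extends⇒admissible stage₀ B-ext
    ... | B-ind , B-total , _ , adm =
      B-basis , Equivalence.from (InH⇔admissible B-basis) (λ ω → adm (∈-descending ω))
      where
      B-basis : IsBasis Z B
      B-basis = independent-transversal⇒basis Z B-ind B-total
    from : IsBasis Z B × InH Z _≺_ B T → Extends descending empty B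
    from (B-basis , inH) = admissible⇒extends stage₀ (empty-⊆ B) (basis⇒transversal Z B-basis)
                                    (λ {ω} _ → Equivalence.to (InH⇔admissible B-basis) inH ω)

corollary3p12 : ∀ {m q : ℕ} → 2 ≤ q → (Z : QMatroid m q) →
    (_≺_ : Fin m → Fin m → Set) → IsStrictTotalOrder _≡_ _≺_ →
    (T : Transversal m q) →
    ∃ λ (L : List (Subtrans m q)) →
      Unique L ×
      (∀ B → (B ∈ L) ⇔ (IsBasis Z B × InH Z _≺_ B T)) ×
      length L ≡ (q ∸ 1) ^ nul Z (toSub T)
corollary3p12 {q = suc (suc k)} (s≤s (s≤s z≤n)) Z _≺_ ≺-sto T =
    extensions descending empty
  , extensions-unique empty descending-unique admissible-unique
  , (λ B → ⇔-trans (mk⇔ (∈-extensions⁻ descending empty) (∈-extensions⁺ descending empty))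
                   extends⇔basis∧InH)
  , trans (length-extensions stage₀) (cong (λ S → suc k ^ nul Z S) fillWithT-descending)
  where
  open Enumeration Z ≺-sto T
  open DescendingEnumeration ≺-sto
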